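{- Let $T_v$ be a colored rooted ternary tree with root $v$, and let $\tilde v\neq v$ be a descendant of $v$ such that every vertex on the path from $v$ to $\tilde v$ other than $\tilde v$ has exactly one child (so $T_v$ consists of $T_{\tilde v}$ together with this path); let $d\geq1$ be the number of edges of this path. Let $\mathbf{v}$ and $\tilde{\mathbf{v}}$ be the root vectors of $T_v$ and $T_{\tilde v}$. If $\tilde{\mathbf{v}}\geq\tilde{\mathbf{e}}=(\varphi^{\tilde e_s})_{s=0,\dots,3}$ with $\tilde e_0,\dots,\tilde e_3\in\mathbb{N}$, then there are $e_0,\dots,e_3\in\mathbb{N}$ such that $\mathbf{v}\geq\mathbf{e}=(\varphi^{e_s})_{s=0,\dots,3}$ and $\Phi(\mathbf{e})\geq\Phi(\tilde{\mathbf{e}})+d$.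
   Context: For a vertex $x$, $T_x$ is the subtree of $x$ and its descendants. $\varphi=(1+\sqrt5)/2$, $\mathbb{N}=\{0,1,2,\dots\}$; for $\mathbf{e}=(\varphi^{e_s})_{s=0,\dots,3}$ with $e_s\in\mathbb{N}$, $\Psi(\mathbf{e})=2(e_1+e_2+e_3)$ and $\Phi(\mathbf{e})=\Psi(\mathbf{e})-|\{s\in\{0,1,2,3\}: e_s>e_0\}|$; $\geq$ between vectors is componentwise. A colored rooted ternary tree is a rooted tree in which every vertex has at most three children, every non-root vertex $x$ has a label $l_x\in\{1,2,3\}$, and children of a common vertex have distinct labels. Its root vector is defined recursively; for a vertex $x$ let $\mathbf{x}=(x_0,x_1,x_2,x_3)$ denote the root vector of $T_x$. For the root $v$: Rule 0: no children gives $\mathbf{v}=(1,1,1,1)$. Rule 1: exactly one child $a$ gives $\mathbf{v}=(a_1,a_0+a_1,a_3,a_2)$, $(a_1,a_3,a_2,a_0+a_1)$ or $(a_1,a_2,a_0+a_1,a_3)$ according as $l_a=1,2,3$. Rule 2: for exactly two children named $a,b$ with $(l_a,l_b)\in\{(1,2),(2,3),(3,1)\}$: $\mathbf{v}=(a_1b_1,a_0b_2+a_1b_3,a_3b_2,a_2b_1+a_3b_0)$ if $l_a=1$; $(a_1b_1,a_3b_2,a_3b_0+a_2b_1,a_1b_3+a_0b_2)$ if $l_a=2$; $(a_1b_1,a_3b_0+a_2b_1,a_0b_2+a_1b_3,a_3b_2)$ if $l_a=3$. Rule 3: three children $a,b,c$ labeled $1,2,3$ give $\mathbf{v}=(a_0b_0c_0+a_1b_1c_1,a_0b_2c_3+a_1b_3c_2,a_2b_3c_0+a_3b_2c_1,a_2b_1c_3+a_3b_0c_2)$.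 -}

module Defs where

open import Data.Nat using (ℕ; zero; suc; _+_; _*_; _∸_; _≤_; _<_; _<?_)
open import Data.Maybe using (Maybe; just; nothing)
open import Data.List using (List; []; _∷_)
open import Data.Product using (_×_)
open import Relation.Nullary.Decidable using (⌊_⌋)
open import Data.Bool using (Bool; true; false)

record Quad (A : Set) : Set where
  constructor ⟨_,_,_,_⟩
  field
    q0 q1 q2 q3 : A
open Quad public

-- Colored rooted ternary tree: a vertex has an optional child with label 1,
-- an optional child with label 2 and an optional child with label 3
-- (so children of a common vertex automatically have distinct labels).
data Tree : Set where
  node : Maybe Tree → Maybe Tree → Maybe Tree → Tree

data Label : Set where
  ℓ1 ℓ2 ℓ3 : Label

rootVec : Tree → Quad ℕ
rootVec (node nothing nothing nothing) = ⟨ 1 , 1 , 1 , 1 ⟩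
rootVec (node (just ta) nothing nothing) with rootVec ta
... | ⟨ a0 , a1 , a2 , a3 ⟩ = ⟨ a1 , a0 + a1 , a3 , a2 ⟩
rootVec (node nothing (just ta) nothing) with rootVec ta
... | ⟨ a0 , a1 , a2 , a3 ⟩ = ⟨ a1 , a3 , a2 , a0 + a1 ⟩
rootVec (node nothing nothing (just ta)) with rootVec ta
... | ⟨ a0 , a1 , a2 , a3 ⟩ = ⟨ a1 , a2 , a0 + a1 , a3 ⟩
rootVec (node (just ta) (just tb) nothing) with rootVec ta | rootVec tb
... | ⟨ a0 , a1 , a2 , a3 ⟩ | ⟨ b0 , b1 , b2 , b3 ⟩ =
  ⟨ a1 * b1 , a0 * b2 + a1 * b3 , a3 * b2 , a2 * b1 + a3 * b0 ⟩
rootVec (node nothing (just ta) (just tb)) with rootVec ta | rootVec tb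
... | ⟨ a0 , a1 , a2 , a3 ⟩ | ⟨ b0 , b1 , b2 , b3 ⟩ =
  ⟨ a1 * b1 , a3 * b2 , a3 * b0 + a2 * b1 , a1 * b3 + a0 * b2 ⟩
-- Rule 2, (l_a , l_b) = (3 , 1): a is the child labelled 3, b the one labelled 1
rootVec (node (just tb) nothing (just ta)) with rootVec ta | rootVec tb
... | ⟨ a0 , a1 , a2 , a3 ⟩ | ⟨ b0 , b1 , b2 , b3 ⟩ =
  ⟨ a1 * b1 , a3 * b0 + a2 * b1 , a0 * b2 + a1 * b3 , a3 * b2 ⟩
rootVec (node (just ta) (just tb) (just tc)) with rootVec ta | rootVec tb | rootVec tc
... | ⟨ a0 , a1 , a2 , a3 ⟩ | ⟨ b0 , b1 , b2 , b3 ⟩ | ⟨ c0 , c1 , c2 , c3 ⟩ =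
  ⟨ a0 * b0 * c0 + a1 * b1 * c1 , a0 * b2 * c3 + a1 * b3 * c2
  , a2 * b3 * c0 + a3 * b2 * c1 , a2 * b1 * c3 + a3 * b0 * c2 ⟩

extend : List Label → Tree → Tree
extend [] t = t
extend (ℓ1 ∷ ls) t = node (just (extend ls t)) nothing nothing
extend (ℓ2 ∷ ls) t = node nothing (just (extend ls t)) nothing
extend (ℓ3 ∷ ls) t = node nothing nothing (just (extend ls t))

-- Fibonacci and Lucas numbers: φ^e = (L e + F e · √5) / 2.
fib : ℕ → ℕ
fib zero = 0
fib (suc zero) = 1
fib (suc (suc n)) = fib (suc n) + fib n

lucas : ℕ → ℕ
lucas zero = 2
lucas (suc zero) = 1
lucas (suc (suc n)) = lucas (suc n) + lucas n

-- φ^e ≤ n, decided exactly in ℤ[√5]: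
-- (L_e + F_e √5)/2 ≤ n  ⟺  L_e ≤ 2n  and  5 F_e² ≤ (2n − L_e)².
_≥φ^_ : ℕ → ℕ → Set
n ≥φ^ e = (lucas e ≤ 2 * n) × (5 * (fib e * fib e) ≤ (2 * n ∸ lucas e) * (2 * n ∸ lucas e))

_≥φ⃗_ : Quad ℕ → Quad ℕ → Set
v ≥φ⃗ e = (q0 v ≥φ^ q0 e) × (q1 v ≥φ^ q1 e) × (q2 v ≥φ^ q2 e) × (q3 v ≥φ^ q3 e)

Ψ : Quad ℕ → ℕ
Ψ e = 2 * (q1 e + q2 e + q3 e)

ind : Bool → ℕ
ind true = 1
ind false = 0

count> : Quad ℕ → ℕ
count> e = ind ⌊ q0 e <? q1 e ⌋ + ind ⌊ q0 e <? q2 e ⌋ + ind ⌊ q0 e <? q3 e ⌋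

-- Φ(e) = Ψ(e) − count; truncated subtraction is exact since Ψ(e) ≥ 2·count(e).
Φ : Quad ℕ → ℕ
Φ e = Ψ e ∸ count> e

-- Adding an edge above a tree with root vector a gives the root vector (a₁, a₀ + a₁, a₂, a₃)
-- up to a permutation of the last three entries, and Φ is symmetric in those entries.
-- The bound φ^e₁ on a₁ moves to the first entry, while a₀ + a₁ ≥ φ^e₀ + φ^e₁ ≥ φ^s with
-- s = e₁, e₁ + 1 or e₁ + 2 according as e₀ < e₁, e₀ = e₁ or e₀ > e₁.  In each case the
-- increase of 2·(exponent sum) pays for the change in the number of exponents exceeding the
-- first one with one unit to spare, so every edge of the path raises Φ by at least 1.
-- Comparisons with powers of φ become integer comparisons with ⌈φ^e⌉, which is the Lucas
-- number L_e or L_e + 1; this rests on the identities L_e² − 5F_e² = ±4.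
module Submission where

open import Defs
open import Data.Nat using (ℕ; zero; suc; _+_; _*_; _∸_; _≤_; _<_; _≤′_; ≤′-refl; ≤′-step; _<?_; z≤n; s≤s; s≤s⁻¹)
open import Data.Nat.Properties
open import Data.Nat.DivMod using (_%_; m%n<n)
open import Data.Nat.Tactic.RingSolver using (solve; solve-∀)
open import Algebra.Properties.CommutativeSemigroup +-commutativeSemigroup using (xy∙z≈xz∙y; xy∙z≈yz∙x)
open import Data.List using (List; []; _∷_; length)
open import Data.Product using (Σ; _×_; _,_)
open import Function.Base using (_∘_)
open import Function.Bundles using (_⇔_; mk⇔; Equivalence)
open import Relation.Nullary.Decidable using (⌊_⌋; yes; no)
open import Relation.Nullary.Negation using (¬_; contradiction)
open import Relation.Binary.Definitions using (tri<; tri≈; tri>)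
open import Relation.Binary.PropositionalEquality using (_≡_; refl; sym; trans; cong; cong₂; module ≡-Reasoning)

_≥[_+_√5]/2 : ℕ → ℕ → ℕ → Set
n ≥[ L + F √5]/2 = (L ≤ 2 * n) × (5 * (F * F) ≤ (2 * n ∸ L) * (2 * n ∸ L))

n≤2*n : ∀ n → n ≤ 2 * n
n≤2*n n = m≤n*m n 2

square-mono : ∀ {m n} → m ≤ n → m * m ≤ n * n
square-mono m≤n = *-mono-≤ m≤n m≤n

a+b≤n⇒2a+b≤2n∸b : ∀ a b n → a + b ≤ n → a + a + b ≤ 2 * n ∸ b
a+b≤n⇒2a+b≤2n∸b a b n a+b≤n = m+n≤o⇒m≤o∸n (a + a + b) (begin
  a + a + b + b   ≡⟨ solve (a ∷ b ∷ []) ⟩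
  2 * (a + b)     ≤⟨ *-monoʳ-≤ 2 a+b≤n ⟩
  2 * n           ∎)
  where open ≤-Reasoning

[2+m]²+4<[3+m]² : ∀ m → (2 + m) * (2 + m) + 4 < (3 + m) * (3 + m)
[2+m]²+4<[3+m]² m = begin-strict
  (2 + m) * (2 + m) + 4                 <⟨ s≤s (m≤m+n _ (2 * m)) ⟩
  1 + ((2 + m) * (2 + m) + 4) + 2 * m   ≡⟨ solve (m ∷ []) ⟩
  (3 + m) * (3 + m)                     ∎
  where open ≤-Reasoning

-- (L + F√5)/2 = L − (L − F√5)/2, and 0 < (L − F√5)/2 = 2/(L + F√5) < 1 unless L = 2.
≥[+√5]/2⇔≥ : ∀ L F {n} → L * L ≡ 5 * (F * F) + 4 → 3 ≤ L → n ≥[ L + F √5]/2 ⇔ L ≤ n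
≥[+√5]/2⇔≥ L@(suc (suc (suc m))) F {n} norm (s≤s (s≤s (s≤s z≤n))) = mk⇔ to from
  where
  open ≤-Reasoning
  to : n ≥[ L + F √5]/2 → L ≤ n
  to (_ , 5F²≤d²) = ≮⇒≥ n≮L
    where
    n≮L : ¬ n < L
    n≮L (s≤s n≤2+m) = <-irrefl refl (begin-strict
      L * L                    ≡⟨ norm ⟩
      5 * (F * F) + 4          ≤⟨ +-monoˡ-≤ 4 (≤-trans 5F²≤d² (square-mono d≤2+m)) ⟩
      (2 + m) * (2 + m) + 4    <⟨ [2+m]²+4<[3+m]² m ⟩
      L * L                    ∎)
      where
      d≤2+m : 2 * n ∸ L ≤ 2 + m
      d≤2+m = m≤n+o⇒m∸n≤o (2 * n) L (begin
        2 * n                  ≤⟨ *-monoʳ-≤ 2 n≤2+m ⟩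
        2 * (2 + m)            ≤⟨ +-mono-≤ (n≤1+n (2 + m)) (≤-reflexive (+-identityʳ (2 + m))) ⟩
        L + (2 + m)            ∎)
  from : L ≤ n → n ≥[ L + F √5]/2
  from L≤n = ≤-trans L≤n (n≤2*n n) , (begin
    5 * (F * F)                 ≤⟨ m≤m+n _ 4 ⟩
    5 * (F * F) + 4             ≡⟨ sym norm ⟩
    L * L                       ≤⟨ square-mono (a+b≤n⇒2a+b≤2n∸b 0 L n L≤n) ⟩
    (2 * n ∸ L) * (2 * n ∸ L)   ∎)

-- Here (L + F√5)/2 = L − (L − F√5)/2 with (L − F√5)/2 = −2/(L + F√5) ∈ (−1, 0).
≥[+√5]/2⇔> : ∀ L F {n} → L * L + 4 ≡ 5 * (F * F) → n ≥[ L + F √5]/2 ⇔ L < n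
≥[+√5]/2⇔> L F {n} norm = mk⇔ to from
  where
  open ≤-Reasoning
  to : n ≥[ L + F √5]/2 → L < n
  to (_ , 5F²≤d²) = ≰⇒> n≰L
    where
    n≰L : ¬ n ≤ L
    n≰L n≤L = m+1+n≰m (L * L) (begin
      L * L + 4               ≡⟨ norm ⟩
      5 * (F * F)             ≤⟨ ≤-trans 5F²≤d² (square-mono d≤L) ⟩
      L * L                   ∎)
      where
      d≤L : 2 * n ∸ L ≤ L
      d≤L = m≤n+o⇒m∸n≤o (2 * n) L (≤-trans (*-monoʳ-≤ 2 n≤L) (≤-reflexive (cong (L +_) (+-identityʳ L))))
  from : L < n → n ≥[ L + F √5]/2
  from L<n = ≤-trans (<⇒≤ L<n) (n≤2*n n) , (begin
    5 * (F * F)                 ≡⟨ sym norm ⟩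
    L * L + 4                   ≤⟨ m≤m+n _ (4 * L) ⟩
    L * L + 4 + 4 * L           ≡⟨ solve (L ∷ []) ⟩
    (2 + L) * (2 + L)           ≤⟨ square-mono (a+b≤n⇒2a+b≤2n∸b 1 L n L<n) ⟩
    (2 * n ∸ L) * (2 * n ∸ L)   ∎)

record Cassini (a b f g : ℕ) : Set where
  field
    even-norm : a * a ≡ 5 * (f * f) + 4
    cross     : a * b ≡ 5 * (f * g) + 2
    odd-norm  : b * b + 4 ≡ 5 * (g * g)

cassini-step : ∀ {a b f g} → Cassini a b f g → Cassini (b + a) (b + a + b) (g + f) (g + f + g)
cassini-step {a} {b} {f} {g} c = record { even-norm = even-norm′ ; cross = cross′ ; odd-norm = odd-norm′ }
  where
  open Cassini c
  open ≡-Reasoning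
  even-norm′ : (b + a) * (b + a) ≡ 5 * ((g + f) * (g + f)) + 4
  even-norm′ = +-cancelʳ-≡ 4 _ _ (begin
    (b + a) * (b + a) + 4
      ≡⟨ solve (a ∷ b ∷ []) ⟩
    (b * b + 4) + 2 * (a * b) + a * a
      ≡⟨ cong₂ (λ x y → x + 2 * y + a * a) odd-norm cross ⟩
    5 * (g * g) + 2 * (5 * (f * g) + 2) + a * a
      ≡⟨ cong (5 * (g * g) + 2 * (5 * (f * g) + 2) +_) even-norm ⟩
    5 * (g * g) + 2 * (5 * (f * g) + 2) + (5 * (f * f) + 4)
      ≡⟨ solve (f ∷ g ∷ []) ⟩
    5 * ((g + f) * (g + f)) + 4 + 4 ∎)
  cross′ : (b + a) * (b + a + b) ≡ 5 * ((g + f) * (g + f + g)) + 2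
  cross′ = +-cancelʳ-≡ 8 _ _ (begin
    (b + a) * (b + a + b) + 8
      ≡⟨ solve (a ∷ b ∷ []) ⟩
    2 * (b * b + 4) + 3 * (a * b) + a * a
      ≡⟨ cong₂ (λ x y → 2 * x + 3 * y + a * a) odd-norm cross ⟩
    2 * (5 * (g * g)) + 3 * (5 * (f * g) + 2) + a * a
      ≡⟨ cong (2 * (5 * (g * g)) + 3 * (5 * (f * g) + 2) +_) even-norm ⟩
    2 * (5 * (g * g)) + 3 * (5 * (f * g) + 2) + (5 * (f * f) + 4)
      ≡⟨ solve (f ∷ g ∷ []) ⟩
    5 * ((g + f) * (g + f + g)) + 2 + 8 ∎)
  odd-norm′ : (b + a + b) * (b + a + b) + 4 ≡ 5 * ((g + f + g) * (g + f + g))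
  odd-norm′ = +-cancelʳ-≡ 12 _ _ (begin
    (b + a + b) * (b + a + b) + 4 + 12
      ≡⟨ solve (a ∷ b ∷ []) ⟩
    4 * (b * b + 4) + 4 * (a * b) + a * a
      ≡⟨ cong₂ (λ x y → 4 * x + 4 * y + a * a) odd-norm cross ⟩
    4 * (5 * (g * g)) + 4 * (5 * (f * g) + 2) + a * a
      ≡⟨ cong (4 * (5 * (g * g)) + 4 * (5 * (f * g) + 2) +_) even-norm ⟩
    4 * (5 * (g * g)) + 4 * (5 * (f * g) + 2) + (5 * (f * f) + 4)
      ≡⟨ solve (f ∷ g ∷ []) ⟩
    5 * ((g + f + g) * (g + f + g)) + 12 ∎)

cassini : ∀ e → e % 2 ≡ 0 → Cassini (lucas e) (lucas (suc e)) (fib e) (fib (suc e))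
cassini zero          _    = record { even-norm = refl ; cross = refl ; odd-norm = refl }
cassini (suc (suc e)) even = cassini-step (cassini e even)

odd⇒suc-even : ∀ n → n % 2 ≡ 1 → suc n % 2 ≡ 0
odd⇒suc-even (suc zero)    _   = refl
odd⇒suc-even (suc (suc n)) odd = odd⇒suc-even n odd

0<lucas : ∀ n → 0 < lucas n
0<lucas zero          = s≤s z≤n
0<lucas (suc zero)    = s≤s z≤n
0<lucas (suc (suc n)) = ≤-trans (0<lucas (suc n)) (m≤m+n _ _)

3≤lucas[2+n] : ∀ n → 3 ≤ lucas (2 + n)
3≤lucas[2+n] zero    = ≤-refl
3≤lucas[2+n] (suc n) = ≤-trans (3≤lucas[2+n] n) (m≤m+n _ (lucas (suc n)))

lucas[1+n]<lucas[2+n] : ∀ n → lucas (suc n) < lucas (2 + n)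
lucas[1+n]<lucas[2+n] n = ≤-trans (≤-reflexive (+-comm 1 _)) (+-monoʳ-≤ (lucas (suc n)) (0<lucas n))

-- For e ≥ 1, φ^e = L_e − (−φ)^(−e) with 0 < φ^(−e) < 1, so ⌈φ^e⌉ = L_e + (e mod 2).
⌈φ^_⌉ : ℕ → ℕ
⌈φ^ zero ⌉  = 1
⌈φ^ suc e ⌉ = suc e % 2 + lucas (suc e)

≥φ^⇔⌈φ^⌉≤ : ∀ e {n} → n ≥φ^ e ⇔ ⌈φ^ e ⌉ ≤ n
≥φ^⇔⌈φ^⌉≤ zero {n} = mk⇔ (λ (2≤2n , _) → *-cancelˡ-≤ 2 2≤2n) (λ 1≤n → *-monoʳ-≤ 2 1≤n , z≤n)
≥φ^⇔⌈φ^⌉≤ (suc zero)    = ≥[+√5]/2⇔> 1 1 refl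
≥φ^⇔⌈φ^⌉≤ (suc (suc e)) with e % 2 in parity | m%n<n e 2
... | 0           | _ = ≥[+√5]/2⇔≥ _ (fib (2 + e)) (Cassini.even-norm (cassini (2 + e) parity)) (3≤lucas[2+n] e)
... | 1           | _ = ≥[+√5]/2⇔> _ (fib (2 + e)) (Cassini.odd-norm (cassini (suc e) (odd⇒suc-even e parity)))
... | suc (suc _) | s≤s (s≤s ())

lucas≤⌈φ^⌉ : ∀ e → lucas (suc e) ≤ ⌈φ^ suc e ⌉
lucas≤⌈φ^⌉ e = m≤n+m _ (suc e % 2)

⌈φ^⌉≤1+lucas : ∀ e → ⌈φ^ suc e ⌉ ≤ suc (lucas (suc e))
⌈φ^⌉≤1+lucas e = +-monoˡ-≤ (lucas (suc e)) (s≤s⁻¹ (m%n<n (suc e) 2))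

⌈φ^⌉≤⌈φ^1+⌉ : ∀ e → ⌈φ^ e ⌉ ≤ ⌈φ^ suc e ⌉
⌈φ^⌉≤⌈φ^1+⌉ zero    = s≤s z≤n
⌈φ^⌉≤⌈φ^1+⌉ (suc e) = ≤-trans (⌈φ^⌉≤1+lucas e) (≤-trans (lucas[1+n]<lucas[2+n] e) (lucas≤⌈φ^⌉ (suc e)))

⌈φ^⌉-mono-≤′ : ∀ {e e′} → e ≤′ e′ → ⌈φ^ e ⌉ ≤ ⌈φ^ e′ ⌉
⌈φ^⌉-mono-≤′ ≤′-refl                      = ≤-refl
⌈φ^⌉-mono-≤′ {e} {suc e′} (≤′-step e≤e′) = ≤-trans (⌈φ^⌉-mono-≤′ e≤e′) (⌈φ^⌉≤⌈φ^1+⌉ e′)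

⌈φ^⌉-mono : ∀ {e e′} → e ≤ e′ → ⌈φ^ e ⌉ ≤ ⌈φ^ e′ ⌉
⌈φ^⌉-mono = ⌈φ^⌉-mono-≤′ ∘ ≤⇒≤′

⌈φ^1+e⌉≤2⌈φ^e⌉ : ∀ e → ⌈φ^ suc e ⌉ ≤ ⌈φ^ e ⌉ + ⌈φ^ e ⌉
⌈φ^1+e⌉≤2⌈φ^e⌉ zero          = ≤-refl
⌈φ^1+e⌉≤2⌈φ^e⌉ (suc zero)    = s≤s (s≤s (s≤s z≤n))
⌈φ^1+e⌉≤2⌈φ^e⌉ (suc (suc n)) = begin
  ⌈φ^ 3 + n ⌉                             ≤⟨ ⌈φ^⌉≤1+lucas (2 + n) ⟩
  suc (lucas (2 + n) + lucas (suc n))     ≡⟨ sym (+-suc _ _) ⟩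
  lucas (2 + n) + suc (lucas (suc n))     ≤⟨ +-monoʳ-≤ (lucas (2 + n)) (lucas[1+n]<lucas[2+n] n) ⟩
  lucas (2 + n) + lucas (2 + n)           ≤⟨ +-mono-≤ (lucas≤⌈φ^⌉ (suc n)) (lucas≤⌈φ^⌉ (suc n)) ⟩
  ⌈φ^ 2 + n ⌉ + ⌈φ^ 2 + n ⌉               ∎
  where open ≤-Reasoning

⌈φ^2+e⌉≤⌈φ^1+e⌉+⌈φ^e⌉ : ∀ e → ⌈φ^ 2 + e ⌉ ≤ ⌈φ^ suc e ⌉ + ⌈φ^ e ⌉
⌈φ^2+e⌉≤⌈φ^1+e⌉+⌈φ^e⌉ zero    = ≤-refl
⌈φ^2+e⌉≤⌈φ^1+e⌉+⌈φ^e⌉ (suc n) = begin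
  suc n % 2 + (lucas (2 + n) + lucas (suc n))            ≤⟨ m≤n+m _ (n % 2) ⟩
  n % 2 + (suc n % 2 + (lucas (2 + n) + lucas (suc n)))  ≡⟨ +-interchange (n % 2) (suc n % 2) (lucas (2 + n)) (lucas (suc n)) ⟩
  ⌈φ^ 2 + n ⌉ + ⌈φ^ suc n ⌉                              ∎
  where
  open ≤-Reasoning
  +-interchange : ∀ p q x y → p + (q + (x + y)) ≡ (p + x) + (q + y)
  +-interchange = solve-∀

-- φ^a + φ^b ≥ φ^b, 2 φ^b ≥ φ^(b+1), and for a > b, φ^a + φ^b ≥ φ^(b+1) + φ^b = φ^(b+2).
sumExponent : ℕ → ℕ → ℕ
sumExponent e₀ e₁ with <-cmp e₀ e₁
... | tri< _ _ _ = e₁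
... | tri≈ _ _ _ = suc e₁
... | tri> _ _ _ = 2 + e₁

⌈φ^sumExponent⌉≤ : ∀ e₀ e₁ → ⌈φ^ sumExponent e₀ e₁ ⌉ ≤ ⌈φ^ e₀ ⌉ + ⌈φ^ e₁ ⌉
⌈φ^sumExponent⌉≤ e₀ e₁ with <-cmp e₀ e₁
... | tri< _ _ _      = m≤n+m ⌈φ^ e₁ ⌉ ⌈φ^ e₀ ⌉
... | tri≈ _ refl _   = ⌈φ^1+e⌉≤2⌈φ^e⌉ e₁
... | tri> _ _ e₁<e₀ = ≤-trans (⌈φ^2+e⌉≤⌈φ^1+e⌉+⌈φ^e⌉ e₁) (+-monoˡ-≤ ⌈φ^ e₁ ⌉ (⌈φ^⌉-mono e₁<e₀))

≥φ^-+ : ∀ a₀ a₁ e₀ e₁ → a₀ ≥φ^ e₀ → a₁ ≥φ^ e₁ → (a₀ + a₁) ≥φ^ sumExponent e₀ e₁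
≥φ^-+ a₀ a₁ e₀ e₁ a₀≥ a₁≥ = Equivalence.from (≥φ^⇔⌈φ^⌉≤ (sumExponent e₀ e₁) {a₀ + a₁})
  (≤-trans (⌈φ^sumExponent⌉≤ e₀ e₁)
    (+-mono-≤ (Equivalence.to (≥φ^⇔⌈φ^⌉≤ e₀ {a₀}) a₀≥) (Equivalence.to (≥φ^⇔⌈φ^⌉≤ e₁ {a₁}) a₁≥)))

[_<_] : ℕ → ℕ → ℕ
[ x < y ] = ind ⌊ x <? y ⌋

[<]≡1 : ∀ {x y} → x < y → [ x < y ] ≡ 1
[<]≡1 {x} {y} x<y with x <? y
... | yes _   = refl
... | no x≮y = contradiction x<y x≮y

[<]≡0 : ∀ {x y} → y ≤ x → [ x < y ] ≡ 0
[<]≡0 {x} {y} y≤x with x <? y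
... | yes x<y = contradiction y≤x (<⇒≱ x<y)
... | no _    = refl

[<]≤1 : ∀ x y → [ x < y ] ≤ 1
[<]≤1 x y with x <? y
... | yes _ = ≤-refl
... | no _  = z≤n

[<]≤ : ∀ x y → [ x < y ] ≤ y
[<]≤ x y with x <? y
... | yes x<y = ≤-trans (s≤s z≤n) x<y
... | no _    = z≤n

[<]-antitone : ∀ {x x′} y → x ≤ x′ → [ x′ < y ] ≤ [ x < y ]
[<]-antitone {x} {x′} y x≤x′ with x′ <? y
... | yes x′<y = ≤-reflexive (sym ([<]≡1 (≤-<-trans x≤x′ x′<y)))
... | no _     = z≤n

count>≤Ψ : ∀ e → count> e ≤ Ψ e
count>≤Ψ ⟨ e₀ , e₁ , e₂ , e₃ ⟩ =
  ≤-trans (+-mono-≤ (+-mono-≤ ([<]≤ e₀ e₁) ([<]≤ e₀ e₂)) ([<]≤ e₀ e₃)) (n≤2*n (e₁ + e₂ + e₃))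

Φ+count>≡Ψ : ∀ e → Φ e + count> e ≡ Ψ e
Φ+count>≡Ψ e = m∸n+n≡m (count>≤Ψ e)

Φ-swap : ∀ x a b c → Φ ⟨ x , a , b , c ⟩ ≡ Φ ⟨ x , a , c , b ⟩
Φ-swap x a b c = cong₂ (λ s k → 2 * s ∸ k) (xy∙z≈xz∙y a b c) (xy∙z≈xz∙y [ x < a ] [ x < b ] [ x < c ])

Φ-rotate : ∀ x a b c → Φ ⟨ x , a , b , c ⟩ ≡ Φ ⟨ x , b , c , a ⟩
Φ-rotate x a b c = cong₂ (λ s k → 2 * s ∸ k) (xy∙z≈yz∙x a b c) (xy∙z≈yz∙x [ x < a ] [ x < b ] [ x < c ])

Φ-increase : ∀ e e′ → Ψ e + 1 + count> e′ ≤ Ψ e′ + count> e → Φ e + 1 ≤ Φ e′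
Φ-increase e e′ gain = m+n≤o⇒m≤o∸n (Φ e + 1) (+-cancelʳ-≤ (count> e) _ _ (begin
  Φ e + 1 + count> e′ + count> e   ≡⟨ rearrange (Φ e) (count> e′) (count> e) ⟩
  Φ e + count> e + 1 + count> e′   ≡⟨ cong (λ x → x + 1 + count> e′) (Φ+count>≡Ψ e) ⟩
  Ψ e + 1 + count> e′              ≤⟨ gain ⟩
  Ψ e′ + count> e                  ∎))
  where
  open ≤-Reasoning
  rearrange : ∀ p c′ c → p + 1 + c′ + c ≡ p + c + 1 + c′
  rearrange = solve-∀

count>-gain : ∀ e₀ e₁ e₂ e₃ → let e = ⟨ e₀ , e₁ , e₂ , e₃ ⟩ ; e′ = ⟨ e₁ , sumExponent e₀ e₁ , e₂ , e₃ ⟩ in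
  Ψ e + 1 + count> e′ ≤ Ψ e′ + count> e
count>-gain e₀ e₁ e₂ e₃ with <-cmp e₀ e₁
... | tri< e₀<e₁ _ _ rewrite [<]≡0 (≤-refl {e₁}) | [<]≡1 e₀<e₁ =
  ≤-trans (≤-reflexive (+-assoc (2 * (e₁ + e₂ + e₃)) 1 _))
    (+-monoʳ-≤ (2 * (e₁ + e₂ + e₃)) (s≤s (+-mono-≤ ([<]-antitone e₂ (<⇒≤ e₀<e₁)) ([<]-antitone e₃ (<⇒≤ e₀<e₁)))))
... | tri≈ _ refl _ rewrite [<]≡0 (≤-refl {e₁}) | [<]≡1 (n<1+n e₁) =
  ≤-reflexive (rearrange e₁ e₂ e₃ [ e₁ < e₂ ] [ e₁ < e₃ ])
  where
  rearrange : ∀ x y z q r → 2 * (x + y + z) + 1 + (1 + q + r) ≡ 2 * (suc x + y + z) + (q + r)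
  rearrange = solve-∀
... | tri> _ _ e₁<e₀ rewrite [<]≡0 (<⇒≤ e₁<e₀) | [<]≡1 (m≤n⇒m≤1+n (n<1+n e₁)) = begin
  2 * (e₁ + e₂ + e₃) + 1 + (1 + [ e₁ < e₂ ] + [ e₁ < e₃ ])
    ≤⟨ +-monoʳ-≤ (2 * (e₁ + e₂ + e₃) + 1) (s≤s (+-mono-≤ ([<]≤1 e₁ e₂) ([<]≤1 e₁ e₃))) ⟩
  2 * (e₁ + e₂ + e₃) + 1 + 3
    ≡⟨ solve (e₁ ∷ e₂ ∷ e₃ ∷ []) ⟩
  2 * (2 + e₁ + e₂ + e₃)
    ≤⟨ m≤m+n _ _ ⟩
  2 * (2 + e₁ + e₂ + e₃) + ([ e₀ < e₂ ] + [ e₀ < e₃ ])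
    ∎
  where open ≤-Reasoning

Φ-gain : ∀ e₀ e₁ e₂ e₃ → Φ ⟨ e₀ , e₁ , e₂ , e₃ ⟩ + 1 ≤ Φ ⟨ e₁ , sumExponent e₀ e₁ , e₂ , e₃ ⟩
Φ-gain e₀ e₁ e₂ e₃ = Φ-increase ⟨ e₀ , e₁ , e₂ , e₃ ⟩ ⟨ e₁ , sumExponent e₀ e₁ , e₂ , e₃ ⟩ (count>-gain e₀ e₁ e₂ e₃)

extend-∷-gain : ∀ l ls t e → rootVec (extend ls t) ≥φ⃗ e →
  Σ (Quad ℕ) λ e′ → (rootVec (extend (l ∷ ls) t) ≥φ⃗ e′) × (Φ e + 1 ≤ Φ e′)
extend-∷-gain l ls t e@(⟨ e₀ , e₁ , e₂ , e₃ ⟩) (h₀ , h₁ , h₂ , h₃) = by-label l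
  where
  v = rootVec (extend ls t)
  s = sumExponent e₀ e₁
  hs : (q0 v + q1 v) ≥φ^ s
  hs = ≥φ^-+ (q0 v) (q1 v) e₀ e₁ h₀ h₁
  gain : Φ e + 1 ≤ Φ ⟨ e₁ , s , e₂ , e₃ ⟩
  gain = Φ-gain e₀ e₁ e₂ e₃
  by-label : ∀ l → Σ (Quad ℕ) λ e′ → (rootVec (extend (l ∷ ls) t) ≥φ⃗ e′) × (Φ e + 1 ≤ Φ e′)
  by-label ℓ1 = ⟨ e₁ , s , e₃ , e₂ ⟩ , (h₁ , hs , h₃ , h₂) ,
    ≤-trans gain (≤-reflexive (Φ-swap e₁ s e₂ e₃))
  by-label ℓ2 = ⟨ e₁ , e₃ , e₂ , s ⟩ , (h₁ , h₃ , h₂ , hs) ,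
    ≤-trans gain (≤-reflexive (trans (Φ-swap e₁ s e₂ e₃) (Φ-rotate e₁ s e₃ e₂)))
  by-label ℓ3 = ⟨ e₁ , e₂ , s , e₃ ⟩ , (h₁ , h₂ , hs , h₃) ,
    ≤-trans gain (≤-reflexive (trans (Φ-rotate e₁ s e₂ e₃) (Φ-swap e₁ e₂ e₃ s)))

extend-gain : ∀ path t ẽ → rootVec t ≥φ⃗ ẽ →
  Σ (Quad ℕ) λ e → (rootVec (extend path t) ≥φ⃗ e) × (Φ ẽ + length path ≤ Φ e)
extend-gain []       t ẽ t≥ẽ = ẽ , t≥ẽ , ≤-reflexive (+-identityʳ (Φ ẽ))
extend-gain (l ∷ ls) t ẽ t≥ẽ with extend-gain ls t ẽ t≥ẽ
... | e , he , ẽ≤e with extend-∷-gain l ls t e he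
...   | e′ , he′ , e<e′ = e′ , he′ , (begin
  Φ ẽ + suc (length ls)   ≡⟨ +-suc (Φ ẽ) (length ls) ⟩
  suc (Φ ẽ + length ls)   ≤⟨ s≤s ẽ≤e ⟩
  suc (Φ e)               ≡⟨ +-comm 1 (Φ e) ⟩
  Φ e + 1                 ≤⟨ e<e′ ⟩
  Φ e′                    ∎)
  where open ≤-Reasoning

lemma17 : (t : Tree) (path : List Label) → 1 ≤ length path →
    (ẽ : Quad ℕ) → rootVec t ≥φ⃗ ẽ →
    Σ (Quad ℕ) (λ e → (rootVec (extend path t) ≥φ⃗ e) × (Φ ẽ + length path ≤ Φ e))
lemma17 t path _ = extend-gain path t
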